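{- Let $n$ be a composite odd natural number. If $n>9$, then $(n-1)!!\equiv 0\pmod n$; moreover $8!!\equiv 6\pmod 9$.
   Context: For a natural number $n$, the double factorial $n!!$ is the product of the natural numbers less than or equal to $n$ that have the same parity as $n$. -}

module Defs where

open import Data.Nat using (ℕ; zero; suc; _*_)

_!! : ℕ → ℕ
zero !! = 1
suc zero !! = 1
suc (suc n) !! = suc (suc n) * (n !!)

{-# OPTIONS --safe #-}
module Submission where

-- Write n = 1 + 2k. Then (n - 1)!! = 2ᵏ · k!, so it suffices that n ∣ k!. Split n = a · b with
-- 3 ≤ a ≤ b. If a < b, then 3b ≤ n gives b ≤ k, so a and b are distinct factors of k!. If a = b,
-- then a ≥ 5 (as n > 9 is odd), so 5a ≤ n gives 2a ≤ k and a · a ∣ a · 2a ∣ k!.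

open import Defs
open import Data.Nat using (ℕ; zero; suc; _+_; _∸_; _*_; _^_; _!; _<_; _≤_; _%_; z≤n; s≤s; s≤s⁻¹; z<s; nonTrivial⇒n>1)
open import Data.Nat.Divisibility
  using (_∣_; divides; ∣-refl; ∣-trans; ∣m∣n⇒∣m+n; m∣m*n; n∣m*n; *-monoʳ-∣; m≤n⇒m!∣n!;
         quotient; quotient>1; m∣n⇒n≡quotient*m)
open import Data.Nat.Divisibility.Core using (hasNonTrivialDivisor)
open import Data.Nat.Primality using (Composite)
open import Data.Nat.Properties
open import Data.Nat.Solver using (module +-*-Solver)
open import Data.Product using (_×_; _,_; ∃-syntax)
open import Data.Sum using (inj₁; inj₂)
open import Data.Empty using (⊥-elim)
open import Relation.Binary using (Tri; tri<; tri≈; tri>)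
open import Relation.Nullary using (¬_)
open import Relation.Binary.PropositionalEquality using (_≡_; refl; sym; trans; cong; subst; module ≡-Reasoning)

[2*n]!!≡2^n*n! : ∀ n → (2 * n) !! ≡ 2 ^ n * n !
[2*n]!!≡2^n*n! zero = refl
[2*n]!!≡2^n*n! (suc n) = begin
  (2 * suc n) !!                 ≡⟨ cong _!! (*-suc 2 n) ⟩
  (2 + 2 * n) * (2 * n) !!       ≡⟨ cong ((2 + 2 * n) *_) ([2*n]!!≡2^n*n! n) ⟩
  (2 + 2 * n) * (2 ^ n * n !)    ≡⟨ solve 3 (λ n p f → (con 2 :+ con 2 :* n) :* (p :* f)
                                                     := con 2 :* p :* ((con 1 :+ n) :* f)) refl n (2 ^ n) (n !) ⟩
  2 ^ suc n * suc n !            ∎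
  where
  open ≡-Reasoning
  open +-*-Solver

m≤n⇒m∣n! : ∀ {m n} → 0 < m → m ≤ n → m ∣ n !
m≤n⇒m∣n! {suc m} _ m≤n = ∣-trans (m∣m*n (m !)) (m≤n⇒m!∣n! m≤n)

m<n≤o⇒m*n∣o! : ∀ {m n o} → 0 < m → m < n → n ≤ o → m * n ∣ o !
m<n≤o⇒m*n∣o! {m} {suc n} 0<m (s≤s m≤n) n≤o =
  ∣-trans (subst (_∣ suc n !) (*-comm (suc n) m) (*-monoʳ-∣ (suc n) (m≤n⇒m∣n! 0<m m≤n)))
          (m≤n⇒m!∣n! n≤o)

2*m<1+2*n⇒m≤n : ∀ {m n} → 2 * m < suc (2 * n) → m ≤ n
2*m<1+2*n⇒m≤n lt = *-cancelˡ-≤ 2 (s≤s⁻¹ lt)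

¬2∣1+2*n : ∀ n → ¬ 2 ∣ suc (2 * n)
¬2∣1+2*n n (divides q eq) = even≢odd q n (trans (*-comm 2 q) (sym eq))

¬2∣n⇒n≡1+2*k : ∀ n → ¬ 2 ∣ n → ∃[ k ] n ≡ suc (2 * k)
¬2∣n⇒n≡1+2*k zero odd = ⊥-elim (odd (divides 0 refl))
¬2∣n⇒n≡1+2*k (suc zero) _ = 0 , refl
¬2∣n⇒n≡1+2*k (suc (suc n)) odd with ¬2∣n⇒n≡1+2*k n (λ 2∣n → odd (∣m∣n⇒∣m+n ∣-refl 2∣n))
... | k , refl = suc k , cong suc (sym (*-suc 2 k))

¬2∣∧1<⇒3≤ : ∀ {d} → ¬ 2 ∣ d → 1 < d → 3 ≤ d
¬2∣∧1<⇒3≤ {suc zero} _ (s≤s ())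
¬2∣∧1<⇒3≤ {suc (suc zero)} odd _ = ⊥-elim (odd ∣-refl)
¬2∣∧1<⇒3≤ {suc (suc (suc _))} _ _ = s≤s (s≤s (s≤s z≤n))

¬2∣∧9<m*m⇒5≤m : ∀ {m} → ¬ 2 ∣ m → 9 < m * m → 5 ≤ m
¬2∣∧9<m*m⇒5≤m {m} odd 9<m*m with m≤n⇒m<n∨m≡n 3<m
  where
  3<m : 3 < m
  3<m = ≰⇒> (λ m≤3 → <⇒≱ 9<m*m (*-mono-≤ m≤3 m≤3))
... | inj₁ 4<m = 4<m
... | inj₂ refl = ⊥-elim (odd (divides 2 refl))

distinct-factors-∣-half! : ∀ {a b} k → 3 ≤ a → a < b → a * b ≡ suc (2 * k) → a * b ∣ k !
distinct-factors-∣-half! {a} {b} k 3≤a a<b ab≡1+2k = m<n≤o⇒m*n∣o! (≤-trans (s≤s z≤n) 3≤a) a<b b≤k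
  where
  b≤k : b ≤ k
  b≤k = 2*m<1+2*n⇒m≤n (begin-strict
    2 * b       <⟨ m<n+m (2 * b) (≤-trans (s≤s z≤n) a<b) ⟩
    3 * b       ≤⟨ *-monoˡ-≤ b 3≤a ⟩
    a * b       ≡⟨ ab≡1+2k ⟩
    suc (2 * k) ∎)
    where open ≤-Reasoning

square-∣-half! : ∀ {a} k → 5 ≤ a → a * a ≡ suc (2 * k) → a * a ∣ k !
square-∣-half! {a@(suc _)} k 5≤a aa≡1+2k =
  ∣-trans (*-monoʳ-∣ a (m∣m*n 2)) (m<n≤o⇒m*n∣o! z<s (m<m*n a 2 (s≤s (s≤s z≤n))) 2a≤k)
  where
  2a≤k : a * 2 ≤ k
  2a≤k = 2*m<1+2*n⇒m≤n (begin-strict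
    2 * (a * 2) ≡⟨ cong (2 *_) (*-comm a 2) ⟩
    2 * (2 * a) ≡⟨ *-assoc 2 2 a ⟨
    4 * a       <⟨ m<n+m (4 * a) z<s ⟩
    5 * a       ≤⟨ *-monoˡ-≤ a 5≤a ⟩
    a * a       ≡⟨ aa≡1+2k ⟩
    suc (2 * k) ∎)
    where open ≤-Reasoning

odd-product-∣-half! : ∀ {a b} k → 1 < a → 1 < b → 9 < a * b → a * b ≡ suc (2 * k) → a * b ∣ k !
odd-product-∣-half! {a} {b} k 1<a 1<b 9<ab ab≡1+2k = by-order (<-cmp a b)
  where
  ¬2∣ab : ¬ 2 ∣ a * b
  ¬2∣ab = subst (λ m → ¬ 2 ∣ m) (sym ab≡1+2k) (¬2∣1+2*n k)
  ¬2∣a : ¬ 2 ∣ a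
  ¬2∣a 2∣a = ¬2∣ab (∣-trans 2∣a (m∣m*n b))
  ¬2∣b : ¬ 2 ∣ b
  ¬2∣b 2∣b = ¬2∣ab (∣-trans 2∣b (n∣m*n a))
  by-order : Tri (a < b) (a ≡ b) (b < a) → a * b ∣ k !
  by-order (tri< a<b _ _) = distinct-factors-∣-half! k (¬2∣∧1<⇒3≤ ¬2∣a 1<a) a<b ab≡1+2k
  by-order (tri> _ _ b<a) = subst (_∣ k !) (*-comm b a)
    (distinct-factors-∣-half! k (¬2∣∧1<⇒3≤ ¬2∣b 1<b) b<a (trans (*-comm b a) ab≡1+2k))
  by-order (tri≈ _ refl _) = square-∣-half! k (¬2∣∧9<m*m⇒5≤m ¬2∣a 9<ab) ab≡1+2k

odd-composite-∣-half! : ∀ {n} k → Composite n → 9 < n → n ≡ suc (2 * k) → n ∣ k !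
odd-composite-∣-half! {n} k (hasNonTrivialDivisor {d} d<n d∣n) 9<n n≡1+2k =
  subst (_∣ k !) (sym n≡q*d)
    (odd-product-∣-half! k (quotient>1 d∣n d<n) (nonTrivial⇒n>1 d)
       (subst (9 <_) n≡q*d 9<n) (trans (sym n≡q*d) n≡1+2k))
  where
  n≡q*d : n ≡ quotient d∣n * d
  n≡q*d = m∣n⇒n≡quotient*m d∣n

odd-composite-∣-[n∸1]!! : ∀ n → Composite n → ¬ 2 ∣ n → 9 < n → n ∣ (n ∸ 1) !!
odd-composite-∣-[n∸1]!! n composite odd 9<n with ¬2∣n⇒n≡1+2*k n odd
... | k , refl = subst (suc (2 * k) ∣_) (sym ([2*n]!!≡2^n*n! k))
                   (∣-trans (odd-composite-∣-half! k composite 9<n refl) (n∣m*n (2 ^ k)))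

theorem6p1 : (∀ (n : ℕ) → Composite n → ¬ (2 ∣ n) → 9 < n → n ∣ ((n ∸ 1) !!))
    × ((8 !!) % 9 ≡ 6)
theorem6p1 = odd-composite-∣-[n∸1]!! , refl
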